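{- Let $b$ be a prime, and let $(\boldsymbol{x}_i)_{i\ge0}\subset[0,1)^b$ be the Faure $(0,b)$-sequence in base $b$, i.e. the $b$-dimensional digital sequence over $\mathbb{F}_b$ with generating matrices $I,P,P^2,\ldots,P^{b-1}$, where $P$ is the infinite upper triangular Pascal matrix over $\mathbb{F}_b$, $P_{i,j}=\binom{j-1}{i-1}\bmod b$ ($i,j\ge1$). Let $w$ be a positive integer, $m=(b-1)b^w$, and $n=b^m-b$. Then \[ \|\boldsymbol{x}_1-\boldsymbol{x}_n\|_\infty\le b^{ -(b^w-1)}. \] In particular, with $Q_{b^m}=\{\boldsymbol{x}_0,\ldots,\boldsymbol{x}_{b^m-1}\}$, \[ q_\infty(Q_{b^m})\le\frac12\|\boldsymbol{x}_1-\boldsymbol{x}_n\|_\infty\le\frac b2\,(b^m)^{ -\frac{1}{b-1}}. \]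
   Context: Digital sequence over $\mathbb{F}_b$ with matrices $C_1,\ldots,C_d$: for an integer $n\ge0$ with $b$-adic expansion $n=n_0+n_1b+\cdots$, $\vec n=(n_0,n_1,\ldots)^\top$, $\vec x_{n,j}=C_j\vec n$ over $\mathbb{F}_b$, $x_{n,j}=\sum_{k\ge1}x_{n,j,k}b^{ -k}$, $\boldsymbol{x}_n=(x_{n,1},\ldots,x_{n,d})$. $q_\infty(Q)=\min_{\boldsymbol{x}\ne\boldsymbol{y}\in Q}\|\boldsymbol{x}-\boldsymbol{y}\|_\infty/2$. -}

module Defs where

open import Data.Nat as ℕ using (ℕ; zero; suc; _∸_; _^_; NonZero)
open import Data.Nat.DivMod using (_/_; _%_)
open import Data.Nat.Combinatorics using (_C_)
open import Data.Nat.Properties using (m^n≢0)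
open import Data.Integer using (+_)
open import Data.Rational as ℚ using (ℚ; 0ℚ; ½)
open import Data.Fin using (Fin; toℕ)
open import Data.List using (List; foldr; map; allFin)
open import Data.Product using (Σ; ∃; _×_; _,_)
open import Relation.Nullary using (¬_)
open import Relation.Binary.PropositionalEquality using (_≡_)

sumℕ : (ℕ → ℕ) → ℕ → ℕ → ℕ
sumℕ f lo zero    = 0
sumℕ f lo (suc l) = f lo ℕ.+ sumℕ f (suc lo) l

sumℚ : (ℕ → ℚ) → ℕ → ℕ → ℚ
sumℚ f lo zero    = 0ℚ
sumℚ f lo (suc l) = f lo ℚ.+ sumℚ f (suc lo) l

sumFromTo : (ℕ → ℕ) → ℕ → ℕ → ℕ
sumFromTo f i N = sumℕ f i (suc N ∸ i)

-- Column vectors over F_b are represented as functions ℕ → ℕ with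
-- 1-based indices (index 0 is unused), entries read modulo b.
-- All vectors below are supported on indices 1..N, where N is a
-- truncation length large enough that all omitted entries are zero.

digitVec : (b : ℕ) → .{{NonZero b}} → ℕ → (ℕ → ℕ)
digitVec b n i = (n / b ^ (i ∸ 1)) {{m^n≢0 b (i ∸ 1)}} % b

-- Multiplication by the upper triangular Pascal matrix over F_b,
-- P_{i,k} = binom(k-1, i-1) mod b, applied to a vector supported on 1..N:
-- (P v)_i = Σ_{k=i}^{N} binom(k-1,i-1) v_k  (mod b).
pascalApply : (b : ℕ) → .{{NonZero b}} → ℕ → (ℕ → ℕ) → (ℕ → ℕ)
pascalApply b N v i = sumFromTo (λ k → ((k ∸ 1) C (i ∸ 1)) ℕ.* v k) i N % b

pascalPow : (b : ℕ) → .{{NonZero b}} → ℕ → ℕ → (ℕ → ℕ) → (ℕ → ℕ)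
pascalPow b N zero    v = v
pascalPow b N (suc j) v = pascalApply b N (pascalPow b N j v)

-- The Faure sequence in base b: coordinate j ∈ {0,…,b-1} (the paper's
-- coordinate j+1) uses generating matrix C_{j+1} = P^j, and
-- x_{n,j+1} = Σ_{k ≥ 1} (P^j \vec n)_k b^{-k}.
-- Truncation length N = n suffices: digit n_{k-1} ≠ 0 forces b^{k-1} ≤ n,
-- hence k ≤ n, and P is upper triangular, so all entries beyond n vanish.
faure : (b : ℕ) → .{{NonZero b}} → ℕ → Fin b → ℚ
faure b n j =
  sumℚ (λ k → ((+ pascalPow b n (toℕ j) (digitVec b n) k) ℚ./ (b ^ k))
                {{m^n≢0 b k}})
       1 n

supNorm : {d : ℕ} → (Fin d → ℚ) → ℚ
supNorm {d} x = foldr ℚ._⊔_ 0ℚ (map (λ j → ℚ.∣ x j ∣) (allFin d))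

distInf : {d : ℕ} → (Fin d → ℚ) → (Fin d → ℚ) → ℚ
distInf x y = supNorm (λ j → x j ℚ.- y j)

DistinctPts : {d : ℕ} → (Fin d → ℚ) → (Fin d → ℚ) → Set
DistinctPts x y = ¬ (∀ j → x j ≡ y j)

IsSepRadiusFaure : (b : ℕ) → .{{NonZero b}} → ℕ → ℚ → Set
IsSepRadiusFaure b M q =
  (∃ λ i → ∃ λ k → i ℕ.< M × k ℕ.< M
     × DistinctPts (faure b i) (faure b k)
     × q ≡ ½ ℚ.* distInf (faure b i) (faure b k))
  × (∀ i k → i ℕ.< M → k ℕ.< M
     → DistinctPts (faure b i) (faure b k)
     → q ℚ.≤ ½ ℚ.* distInf (faure b i) (faure b k))

powℚ : ℚ → ℕ → ℚ
powℚ r zero    = ℚ.1ℚ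
powℚ r (suc k) = r ℚ.* powℚ r k

{-# OPTIONS --safe #-}
module Submission where

-- Let P be the Pascal matrix, K = bʷ and M = (b - 1) K.  The digit vector of 1 is e₁ and
-- Pʲ e₁ = e₁, so every coordinate of x₁ is 1/b.  The digit vector of n = bᴹ - b is
-- V = (b - 1)(e₂ + ⋯ + e_M), and the entries of Pʲ are the coefficients of the powers
-- (y + j)ˢ, so entry a + 1 of Pʲ V is, up to the factor b - 1 ≡ -1, the coefficient of yᵃ in
-- Σ_{1≤s<M} (y + j)ˢ.  Multiplying by y + j - 1 telescopes the sum to (y + j)ᴹ - 1, and
-- (y + j)ᴹ ≡ jᴹ ≡ 1 modulo b and yᴷ, because b divides (M choose a) for 0 < a < K and by
-- Fermat.  Hence for j ≥ 1 the digits of xₙ at positions 1, …, K - 1 are 1, 0, …, 0, those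
-- of x₁, while in coordinate 0 they are 0, b - 1, …, b - 1.  In both cases the remaining
-- digits keep the coordinates within b^-(K-1) of each other, and in coordinate 0 they differ.
-- Finally b^-(K-1) = b · b^-K with b^-K = (bᴹ)^(-1/(b-1)).

open import Defs
open import Data.Nat as ℕ
  using (ℕ; zero; suc; _+_; _*_; _∸_; _^_; _≤_; _<_; z≤n; s≤s; z<s; NonZero; ∣_-_∣)
open import Data.Nat.Properties
open import Data.Nat.DivMod
  using ( _/_; _%_; %-distribˡ-+; %-distribˡ-*; %-remove-+ʳ; m≡m%n+[m/n]*n; m%n%n≡m%n; m%n<n
        ; m<n⇒m/n≡0; n/1≡n; m*n%n≡0; +-distrib-/; m*n/n≡m; [m+kn]%n≡m%n; m<n⇒m%n≡m)
open import Data.Nat.Divisibility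
  using ( _∣_; divides; _∣?_; ∣-refl; ∣-trans; ∣⇒≤; m∣m*n; n∣m*n; ∣m⇒∣m*n; *-monoʳ-∣; *-cancelˡ-∣
        ; n∣m⇒m%n≡0; _∣0; 1∣_; >⇒∤)
open import Data.Nat.Combinatorics
  using (_C_; nCk+nC[k+1]≡[n+1]C[k+1]; k>n⇒nCk≡0; nCn≡1; nC1≡n)
open import Data.Nat.Primality using (Prime; euclidsLemma; ¬prime[1])
open import Data.Nat.Solver using (module +-*-Solver)
open import Data.Integer as ℤ using (+≤+; +<+)
import Data.Integer.Properties as ℤₚ
open import Data.Rational as ℚ using (ℚ; 0ℚ; 1ℚ; ½)
import Data.Rational.Properties as ℚₚ
open import Data.Rational.Unnormalised as ℚᵘ using (mkℚᵘ; *≡*; *≤*; *<*)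
import Data.Rational.Unnormalised.Properties as ℚᵘₚ
import Data.Rational.Solver as ℚSolver
open import Data.List using ([]; _∷_; foldr; map; allFin)
open import Data.Fin using (Fin; toℕ) renaming (zero to fzero; suc to fsuc)
import Data.Fin.Properties as Finₚ
open import Data.Product using (_×_; _,_)
open import Data.Sum using (_⊎_; inj₁; inj₂)
open import Data.Empty using (⊥-elim)
open import Function using (_∘_)
open import Level using (0ℓ)
open import Relation.Nullary using (¬_; yes; no)
open import Relation.Binary.Bundles using (Setoid)
import Relation.Binary.Reasoning.Setoid as SetoidReasoning
open import Relation.Binary.PropositionalEquality

open +-*-Solver using (solve; _:+_; _:*_; _:=_; con)
open ℚSolver.+-*-Solver
  using () renaming (solve to ℚsolve; _:+_ to _ℚ:+_; _:-_ to _ℚ:-_; :-_ to ℚ:-_; _:=_ to _ℚ:=_)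

-- Finite sums

sumℕ-cong : ∀ (f g : ℕ → ℕ) lo len → (∀ k → lo ≤ k → k < lo + len → f k ≡ g k) →
            sumℕ f lo len ≡ sumℕ g lo len
sumℕ-cong f g lo zero      f≡g = refl
sumℕ-cong f g lo (suc len) f≡g =
  cong₂ _+_ (f≡g lo ≤-refl (m<m+n lo z<s))
            (sumℕ-cong f g (suc lo) len λ k lo<k k<end →
               f≡g k (<⇒≤ lo<k) (subst (k <_) (sym (+-suc lo len)) k<end))

sumℕ-ext : ∀ (f g : ℕ → ℕ) lo len → (∀ k → f k ≡ g k) → sumℕ f lo len ≡ sumℕ g lo len
sumℕ-ext f g lo len f≡g = sumℕ-cong f g lo len (λ k _ _ → f≡g k)

sumℕ-zero : ∀ (f : ℕ → ℕ) lo len → (∀ k → lo ≤ k → k < lo + len → f k ≡ 0) → sumℕ f lo len ≡ 0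
sumℕ-zero f lo len f≡0 = trans (sumℕ-cong f (λ _ → 0) lo len f≡0) (sum0 lo len)
  where
  sum0 : ∀ lo len → sumℕ (λ _ → 0) lo len ≡ 0
  sum0 lo zero      = refl
  sum0 lo (suc len) = sum0 (suc lo) len

sumℕ-shift : ∀ (f : ℕ → ℕ) lo len → sumℕ f (suc lo) len ≡ sumℕ (f ∘ suc) lo len
sumℕ-shift f lo zero      = refl
sumℕ-shift f lo (suc len) = cong (f (suc lo) +_) (sumℕ-shift f (suc lo) len)

sumℕ-head : ∀ (f : ℕ → ℕ) len → sumℕ f 0 (suc len) ≡ f 0 + sumℕ (f ∘ suc) 0 len
sumℕ-head f len = cong (f 0 +_) (sumℕ-shift f 0 len)

sumℕ-++ : ∀ (f : ℕ → ℕ) lo x y → sumℕ f lo (x + y) ≡ sumℕ f lo x + sumℕ f (lo + x) y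
sumℕ-++ f lo zero    y = cong (λ l → sumℕ f l y) (sym (+-identityʳ lo))
sumℕ-++ f lo (suc x) y rewrite sumℕ-++ f (suc lo) x y | +-suc lo x =
  sym (+-assoc (f lo) _ _)

sumℕ-last : ∀ (f : ℕ → ℕ) lo len → sumℕ f lo (suc len) ≡ sumℕ f lo len + f (lo + len)
sumℕ-last f lo len = begin
  sumℕ f lo (suc len)                   ≡⟨ cong (sumℕ f lo) (+-comm 1 len) ⟩
  sumℕ f lo (len + 1)                   ≡⟨ sumℕ-++ f lo len 1 ⟩
  sumℕ f lo len + (f (lo + len) + 0)    ≡⟨ cong (sumℕ f lo len +_) (+-identityʳ _) ⟩
  sumℕ f lo len + f (lo + len)          ∎
  where open ≡-Reasoning

sumℕ-distrib-+ : ∀ (f g : ℕ → ℕ) lo len →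
                 sumℕ (λ k → f k + g k) lo len ≡ sumℕ f lo len + sumℕ g lo len
sumℕ-distrib-+ f g lo zero      = refl
sumℕ-distrib-+ f g lo (suc len) rewrite sumℕ-distrib-+ f g (suc lo) len =
  solve 4 (λ a b c d → (a :+ b) :+ (c :+ d) := (a :+ c) :+ (b :+ d)) refl
    (f lo) (g lo) (sumℕ f (suc lo) len) (sumℕ g (suc lo) len)

*-distribˡ-sumℕ : ∀ c (f : ℕ → ℕ) lo len → sumℕ (λ k → c * f k) lo len ≡ c * sumℕ f lo len
*-distribˡ-sumℕ c f lo zero      = sym (*-zeroʳ c)
*-distribˡ-sumℕ c f lo (suc len) rewrite *-distribˡ-sumℕ c f (suc lo) len =
  sym (*-distribˡ-+ c (f lo) _)

sumℕ-comm : ∀ (g : ℕ → ℕ → ℕ) lo₁ len₁ lo₂ len₂ →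
            sumℕ (λ k → sumℕ (g k) lo₂ len₂) lo₁ len₁
              ≡ sumℕ (λ s → sumℕ (λ k → g k s) lo₁ len₁) lo₂ len₂
sumℕ-comm g lo₁ zero       lo₂ len₂ = sym (sumℕ-zero _ lo₂ len₂ (λ _ _ _ → refl))
sumℕ-comm g lo₁ (suc len₁) lo₂ len₂ rewrite sumℕ-comm g (suc lo₁) len₁ lo₂ len₂ =
  sym (sumℕ-distrib-+ (g lo₁) (λ s → sumℕ (λ k → g k s) (suc lo₁) len₁) lo₂ len₂)

-- Congruences

module Modular (p : ℕ) .{{_ : NonZero p}} where

  infix 4 _≈_
  record _≈_ (x y : ℕ) : Set where
    constructor mk≈
    field un≈ : x % p ≡ y % p
  open _≈_ public

  ≈-refl : ∀ {x} → x ≈ x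
  ≈-refl = mk≈ refl

  ≈-sym : ∀ {x y} → x ≈ y → y ≈ x
  ≈-sym (mk≈ e) = mk≈ (sym e)

  ≈-trans : ∀ {x y z} → x ≈ y → y ≈ z → x ≈ z
  ≈-trans (mk≈ e) (mk≈ f) = mk≈ (trans e f)

  ≡⇒≈ : ∀ {x y} → x ≡ y → x ≈ y
  ≡⇒≈ refl = ≈-refl

  ≈-setoid : Setoid 0ℓ 0ℓ
  ≈-setoid = record
    { Carrier = ℕ
    ; _≈_ = _≈_
    ; isEquivalence = record { refl = ≈-refl ; sym = ≈-sym ; trans = ≈-trans } }

  module ≈-Reasoning = SetoidReasoning ≈-setoid

  +-cong : ∀ {a a′ c c′} → a ≈ a′ → c ≈ c′ → a + c ≈ a′ + c′
  +-cong {a} {a′} {c} {c′} (mk≈ e₁) (mk≈ e₂) = mk≈ (begin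
    (a + c) % p              ≡⟨ %-distribˡ-+ a c p ⟩
    (a % p + c % p) % p      ≡⟨ cong₂ (λ u v → (u + v) % p) e₁ e₂ ⟩
    (a′ % p + c′ % p) % p    ≡⟨ %-distribˡ-+ a′ c′ p ⟨
    (a′ + c′) % p            ∎)
    where open ≡-Reasoning

  *-cong : ∀ {a a′ c c′} → a ≈ a′ → c ≈ c′ → a * c ≈ a′ * c′
  *-cong {a} {a′} {c} {c′} (mk≈ e₁) (mk≈ e₂) = mk≈ (begin
    (a * c) % p              ≡⟨ %-distribˡ-* a c p ⟩
    (a % p * (c % p)) % p    ≡⟨ cong₂ (λ u v → (u * v) % p) e₁ e₂ ⟩
    (a′ % p * (c′ % p)) % p  ≡⟨ %-distribˡ-* a′ c′ p ⟨
    (a′ * c′) % p            ∎)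
    where open ≡-Reasoning

  ^-cong : ∀ {a a′} k → a ≈ a′ → a ^ k ≈ a′ ^ k
  ^-cong zero    _ = ≈-refl
  ^-cong (suc k) e = *-cong e (^-cong k e)

  ∣⇒≈0 : ∀ {x} → p ∣ x → x ≈ 0
  ∣⇒≈0 {x} p∣x = mk≈ (trans (n∣m⇒m%n≡0 x p p∣x) (sym (0%p p)))
    where
    0%p : ∀ q .{{_ : NonZero q}} → 0 % q ≡ 0
    0%p (suc q) = refl

  sumℕ-cong-≈ : ∀ (f g : ℕ → ℕ) lo len → (∀ k → lo ≤ k → k < lo + len → f k ≈ g k) →
                sumℕ f lo len ≈ sumℕ g lo len
  sumℕ-cong-≈ f g lo zero      f≈g = ≈-refl
  sumℕ-cong-≈ f g lo (suc len) f≈g =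
    +-cong (f≈g lo ≤-refl (m<m+n lo z<s))
           (sumℕ-cong-≈ f g (suc lo) len λ k lo<k k<end →
              f≈g k (<⇒≤ lo<k) (subst (k <_) (sym (+-suc lo len)) k<end))

  +≈⇒∣ : ∀ x d → x + d ≈ x → p ∣ d
  +≈⇒∣ x d (mk≈ e) = divides ((x + d) / p ∸ x / p) (begin
    d
      ≡⟨ m+n∸m≡n x d ⟨
    (x + d) ∸ x
      ≡⟨ cong₂ _∸_ (m≡m%n+[m/n]*n (x + d) p) (m≡m%n+[m/n]*n x p) ⟩
    ((x + d) % p + (x + d) / p * p) ∸ (x % p + x / p * p)
      ≡⟨ cong (λ r → (r + (x + d) / p * p) ∸ (x % p + x / p * p)) e ⟩
    (x % p + (x + d) / p * p) ∸ (x % p + x / p * p)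
      ≡⟨ [m+n]∸[m+o]≡n∸o (x % p) _ _ ⟩
    (x + d) / p * p ∸ x / p * p
      ≡⟨ *-distribʳ-∸ p ((x + d) / p) (x / p) ⟨
    ((x + d) / p ∸ x / p) * p ∎)
    where open ≡-Reasoning

  ∣⇒+≈ : ∀ x d → p ∣ d → x + d ≈ x
  ∣⇒+≈ x d p∣d = mk≈ (%-remove-+ʳ x p∣d)

  ≈⇒∣∣-∣ : ∀ x y → x ≈ y → p ∣ ∣ x - y ∣
  ≈⇒∣∣-∣ x y x≈y with ≤-total x y
  ... | inj₁ x≤y = subst (p ∣_) (sym (m≤n⇒∣m-n∣≡n∸m x≤y))
                     (+≈⇒∣ x (y ∸ x) (≈-trans (≡⇒≈ (m+[n∸m]≡n x≤y)) (≈-sym x≈y)))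
  ... | inj₂ y≤x = subst (p ∣_) (sym (m≤n⇒∣n-m∣≡n∸m y≤x))
                     (+≈⇒∣ y (x ∸ y) (≈-trans (≡⇒≈ (m+[n∸m]≡n y≤x)) x≈y))

  ∣∣-∣⇒≈ : ∀ x y → p ∣ ∣ x - y ∣ → x ≈ y
  ∣∣-∣⇒≈ x y p∣x-y with ≤-total x y
  ... | inj₁ x≤y = ≈-sym (≈-trans (≡⇒≈ (sym (m+[n∸m]≡n x≤y)))
                     (∣⇒+≈ x (y ∸ x) (subst (p ∣_) (m≤n⇒∣m-n∣≡n∸m x≤y) p∣x-y)))
  ... | inj₂ y≤x = ≈-trans (≡⇒≈ (sym (m+[n∸m]≡n y≤x)))
                     (∣⇒+≈ y (x ∸ y) (subst (p ∣_) (m≤n⇒∣n-m∣≡n∸m y≤x) p∣x-y))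

  +-cancelˡ-≈ : ∀ x {y z} → x + y ≈ x + z → y ≈ z
  +-cancelˡ-≈ x {y} {z} e =
    ∣∣-∣⇒≈ y z (subst (p ∣_) (∣m+n-m+o∣≡∣n-o∣ x y z) (≈⇒∣∣-∣ (x + y) (x + z) e))

-- Binomial coefficients and the powers (y + j)ˢ

pascal : ∀ n k → suc n C suc k ≡ n C k + n C suc k
pascal n k = sym (nCk+nC[k+1]≡[n+1]C[k+1] n k)

[1+k]*[1+n]C[1+k]≡[1+n]*nCk : ∀ n k → suc k * (suc n C suc k) ≡ suc n * (n C k)
[1+k]*[1+n]C[1+k]≡[1+n]*nCk zero zero = refl
[1+k]*[1+n]C[1+k]≡[1+n]*nCk zero (suc k)
  rewrite k>n⇒nCk≡0 {1} {suc (suc k)} (s≤s (s≤s z≤n)) | k>n⇒nCk≡0 {0} {suc k} (s≤s z≤n) =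
  *-zeroʳ (suc (suc k))
[1+k]*[1+n]C[1+k]≡[1+n]*nCk (suc n) zero
  rewrite nC1≡n (suc (suc n)) = trans (+-identityʳ _) (sym (*-identityʳ (suc (suc n))))
[1+k]*[1+n]C[1+k]≡[1+n]*nCk (suc n) (suc k) = begin
  suc (suc k) * (suc N C suc (suc k))
    ≡⟨ cong (suc (suc k) *_) (pascal N (suc k)) ⟩
  suc (suc k) * (N C suc k + N C suc (suc k))
    ≡⟨ *-distribˡ-+ (suc (suc k)) (N C suc k) (N C suc (suc k)) ⟩
  (N C suc k + suc k * (N C suc k)) + suc (suc k) * (N C suc (suc k))
    ≡⟨ cong₂ (λ t t′ → (N C suc k + t) + t′) (absorb n k) (absorb n (suc k)) ⟩
  (N C suc k + N * (n C k)) + N * (n C suc k)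
    ≡⟨ +-assoc (N C suc k) (N * (n C k)) (N * (n C suc k)) ⟩
  N C suc k + (N * (n C k) + N * (n C suc k))
    ≡⟨ cong (N C suc k +_) (*-distribˡ-+ N (n C k) (n C suc k)) ⟨
  N C suc k + N * (n C k + n C suc k)
    ≡⟨ cong (λ t → N C suc k + N * t) (pascal n k) ⟨
  N C suc k + N * (N C suc k) ∎
  where
  open ≡-Reasoning
  N = suc n
  absorb = [1+k]*[1+n]C[1+k]≡[1+n]*nCk

-- powCoeff j s a is the coefficient of yᵃ in (y + j)ˢ, i.e. the entry (a + 1 , s + 1) of Pʲ.

powCoeff : ℕ → ℕ → ℕ → ℕ
powCoeff j zero    zero    = 1
powCoeff j zero    (suc a) = 0
powCoeff j (suc s) zero    = j * powCoeff j s zero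
powCoeff j (suc s) (suc a) = powCoeff j s a + j * powCoeff j s (suc a)

powCoeff-zero : ∀ j s → powCoeff j s 0 ≡ j ^ s
powCoeff-zero j zero    = refl
powCoeff-zero j (suc s) = cong (j *_) (powCoeff-zero j s)

powCoeff≡C*^ : ∀ j s a → powCoeff j s a ≡ (s C a) * j ^ (s ∸ a)
powCoeff≡C*^ j zero    zero    = refl
powCoeff≡C*^ j zero    (suc a) rewrite k>n⇒nCk≡0 {0} {suc a} (s≤s z≤n) = refl
powCoeff≡C*^ j (suc s) zero    rewrite powCoeff-zero j s = sym (+-identityʳ _)
powCoeff≡C*^ j (suc s) (suc a) = begin
  powCoeff j s a + j * powCoeff j s (suc a)
    ≡⟨ cong₂ (λ u v → u + j * v) (powCoeff≡C*^ j s a) (powCoeff≡C*^ j s (suc a)) ⟩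
  (s C a) * j ^ (s ∸ a) + j * ((s C suc a) * j ^ (s ∸ suc a))
    ≡⟨ cong ((s C a) * j ^ (s ∸ a) +_) shift ⟩
  (s C a) * j ^ (s ∸ a) + (s C suc a) * j ^ (s ∸ a)
    ≡⟨ *-distribʳ-+ (j ^ (s ∸ a)) (s C a) _ ⟨
  (s C a + s C suc a) * j ^ (s ∸ a)
    ≡⟨ cong (_* j ^ (s ∸ a)) (pascal s a) ⟨
  (suc s C suc a) * j ^ (s ∸ a) ∎
  where
  open ≡-Reasoning
  shift : j * ((s C suc a) * j ^ (s ∸ suc a)) ≡ (s C suc a) * j ^ (s ∸ a)
  shift with a <? s
  ... | yes a<s rewrite +-∸-assoc 1 a<s =
    solve 3 (λ j c x → j :* (c :* x) := c :* (j :* x)) refl j (s C suc a) _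
  ... | no a≮s rewrite k>n⇒nCk≡0 {s} {suc a} (s≤s (≮⇒≥ a≮s)) = *-zeroʳ j

powCoeff-one : ∀ s a → powCoeff 1 s a ≡ s C a
powCoeff-one s a = begin
  powCoeff 1 s a            ≡⟨ powCoeff≡C*^ 1 s a ⟩
  (s C a) * 1 ^ (s ∸ a)     ≡⟨ cong ((s C a) *_) (^-zeroˡ (s ∸ a)) ⟩
  (s C a) * 1               ≡⟨ *-identityʳ _ ⟩
  s C a                     ∎
  where open ≡-Reasoning

sumℕ-powCoeff : ∀ j s X → s < X → sumℕ (powCoeff j s) 0 X ≡ suc j ^ s
sumℕ-powCoeff j zero    (suc X) _ =
  cong (1 +_) (trans (sumℕ-shift (powCoeff j 0) 0 X) (sumℕ-zero _ 0 X (λ _ _ _ → refl)))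
sumℕ-powCoeff j (suc s) (suc X) (s≤s s<X) = begin
  sumℕ (powCoeff j (suc s)) 0 (suc X)
    ≡⟨ sumℕ-head _ X ⟩
  j * A₀ + sumℕ (λ a → powCoeff j s a + j * powCoeff j s (suc a)) 0 X
    ≡⟨ cong (j * A₀ +_) (trans (sumℕ-distrib-+ _ _ 0 X) (cong (A +_) (*-distribˡ-sumℕ j _ 0 X))) ⟩
  j * A₀ + (A + j * B)
    ≡⟨ solve 4 (λ j x a b → j :* x :+ (a :+ j :* b) := a :+ j :* (x :+ b)) refl j A₀ A B ⟩
  A + j * (A₀ + B)
    ≡⟨ cong₂ (λ u v → u + j * v) (sumℕ-powCoeff j s X s<X)
             (trans (sym (sumℕ-head _ X)) (sumℕ-powCoeff j s (suc X) (m<n⇒m<1+n s<X))) ⟩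
  suc j ^ s + j * suc j ^ s ∎
  where
  open ≡-Reasoning
  A₀ = powCoeff j s 0
  A  = sumℕ (powCoeff j s) 0 X
  B  = sumℕ (λ a → powCoeff j s (suc a)) 0 X

-- Substituting y ↦ y + 1 in (y + j)ˢ; in matrix form Pʲ P = Pʲ⁺¹.
sumℕ-powCoeff*C : ∀ j s X a → s < X → sumℕ (λ r → powCoeff j s r * (r C a)) 0 X ≡ powCoeff (suc j) s a
sumℕ-powCoeff*C j zero (suc X) a _ = begin
  sumℕ (λ r → powCoeff j 0 r * (r C a)) 0 (suc X) ≡⟨ sumℕ-head _ X ⟩
  1 * (0 C a) + sumℕ (λ _ → 0) 0 X                ≡⟨ cong (1 * (0 C a) +_) (sumℕ-zero _ 0 X λ _ _ _ → refl) ⟩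
  1 * (0 C a) + 0                                 ≡⟨ trans (+-identityʳ _) (*-identityˡ _) ⟩
  0 C a                                           ≡⟨ base a ⟩
  powCoeff (suc j) 0 a                            ∎
  where
  open ≡-Reasoning
  base : ∀ a → 0 C a ≡ powCoeff (suc j) 0 a
  base zero    = refl
  base (suc a) = k>n⇒nCk≡0 {0} {suc a} (s≤s z≤n)
sumℕ-powCoeff*C j (suc s) (suc X) a (s≤s s<X) = begin
  sumℕ (λ r → powCoeff j (suc s) r * (r C a)) 0 (suc X)
    ≡⟨ sumℕ-head _ X ⟩
  j * A₀ * (0 C a) + sumℕ (λ r → (powCoeff j s r + j * powCoeff j s (suc r)) * (suc r C a)) 0 X
    ≡⟨ cong (j * A₀ * (0 C a) +_) (trans (sumℕ-ext _ _ 0 X distrib)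
          (trans (sumℕ-distrib-+ _ _ 0 X) (cong (A +_) (*-distribˡ-sumℕ j _ 0 X)))) ⟩
  j * A₀ * (0 C a) + (A + j * B)
    ≡⟨ solve 5 (λ j x c a b → j :* x :* c :+ (a :+ j :* b) := a :+ j :* (x :* c :+ b))
               refl j A₀ (0 C a) A B ⟩
  A + j * (A₀ * (0 C a) + B)
    ≡⟨ cong (λ t → A + j * t) (trans (sym (sumℕ-head _ X))
                                     (sumℕ-powCoeff*C j s (suc X) a (m<n⇒m<1+n s<X))) ⟩
  A + j * powCoeff (suc j) s a
    ≡⟨ last a ⟩
  powCoeff (suc j) (suc s) a ∎
  where
  open ≡-Reasoning
  A₀ = powCoeff j s 0
  A  = sumℕ (λ r → powCoeff j s r * (suc r C a)) 0 X
  B  = sumℕ (λ r → powCoeff j s (suc r) * (suc r C a)) 0 X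
  distrib : ∀ r → (powCoeff j s r + j * powCoeff j s (suc r)) * (suc r C a)
                ≡ powCoeff j s r * (suc r C a) + j * (powCoeff j s (suc r) * (suc r C a))
  distrib r = solve 4 (λ x y j c → (x :+ j :* y) :* c := x :* c :+ j :* (y :* c)) refl
                (powCoeff j s r) (powCoeff j s (suc r)) j (suc r C a)
  last : ∀ a → sumℕ (λ r → powCoeff j s r * (suc r C a)) 0 X + j * powCoeff (suc j) s a
             ≡ powCoeff (suc j) (suc s) a
  last zero    = cong (_+ j * powCoeff (suc j) s 0) (sumℕ-powCoeff*C j s X 0 s<X)
  last (suc a) = begin
    sumℕ (λ r → powCoeff j s r * (suc r C suc a)) 0 X + j * powCoeff (suc j) s (suc a)
      ≡⟨ cong (_+ j * powCoeff (suc j) s (suc a)) (trans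
           (sumℕ-ext _ _ 0 X λ r →
              trans (cong (powCoeff j s r *_) (pascal r a)) (*-distribˡ-+ (powCoeff j s r) _ _))
           (trans (sumℕ-distrib-+ _ _ 0 X)
                  (cong₂ _+_ (sumℕ-powCoeff*C j s X a s<X) (sumℕ-powCoeff*C j s X (suc a) s<X)))) ⟩
    powCoeff (suc j) s a + powCoeff (suc j) s (suc a) + j * powCoeff (suc j) s (suc a)
      ≡⟨ +-assoc (powCoeff (suc j) s a) _ _ ⟩
    powCoeff (suc j) (suc s) (suc a) ∎

geomCoeff : ℕ → ℕ → ℕ → ℕ
geomCoeff j M a = sumℕ (λ s → powCoeff j s a) 0 M

-- The coefficients of (y + j - 1) Σ_{s<M} (y + j)ˢ = (y + j)ᴹ - 1, with both sides moved
-- so that no subtraction occurs.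

geomCoeff-telescope : ∀ j M a →
  sumℕ (λ s → powCoeff j (suc s) a) 0 M + powCoeff j 0 a ≡ geomCoeff j M a + powCoeff j M a
geomCoeff-telescope j M a = begin
  sumℕ (λ s → powCoeff j (suc s) a) 0 M + powCoeff j 0 a  ≡⟨ +-comm _ (powCoeff j 0 a) ⟩
  powCoeff j 0 a + sumℕ (λ s → powCoeff j (suc s) a) 0 M  ≡⟨ sumℕ-head (λ s → powCoeff j s a) M ⟨
  sumℕ (λ s → powCoeff j s a) 0 (suc M)                   ≡⟨ sumℕ-last (λ s → powCoeff j s a) 0 M ⟩
  geomCoeff j M a + powCoeff j M a                         ∎
  where open ≡-Reasoning

geomCoeff-zero : ∀ j M → j * geomCoeff j M 0 + 1 ≡ geomCoeff j M 0 + powCoeff j M 0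
geomCoeff-zero j M =
  trans (cong (_+ 1) (sym (*-distribˡ-sumℕ j (λ s → powCoeff j s 0) 0 M))) (geomCoeff-telescope j M 0)

geomCoeff-suc : ∀ j M a →
  geomCoeff j M a + j * geomCoeff j M (suc a) ≡ geomCoeff j M (suc a) + powCoeff j M (suc a)
geomCoeff-suc j M a = begin
  geomCoeff j M a + j * geomCoeff j M (suc a)
    ≡⟨ cong (geomCoeff j M a +_) (*-distribˡ-sumℕ j (λ s → powCoeff j s (suc a)) 0 M) ⟨
  geomCoeff j M a + sumℕ (λ s → j * powCoeff j s (suc a)) 0 M
    ≡⟨ sumℕ-distrib-+ (λ s → powCoeff j s a) (λ s → j * powCoeff j s (suc a)) 0 M ⟨
  sumℕ (λ s → powCoeff j (suc s) (suc a)) 0 M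
    ≡⟨ +-identityʳ _ ⟨
  sumℕ (λ s → powCoeff j (suc s) (suc a)) 0 M + 0
    ≡⟨ geomCoeff-telescope j M (suc a) ⟩
  geomCoeff j M (suc a) + powCoeff j M (suc a) ∎
  where open ≡-Reasoning

module PrimeModulus (p-1 : ℕ) (isPrime : Prime (suc p-1)) where

  p : ℕ
  p = suc p-1

  open Modular p public

  euclid : ∀ {m n} → p ∣ m * n → p ∣ m ⊎ p ∣ n
  euclid {m} {n} = euclidsLemma m n isPrime

  *-cancelˡ-≈ : ∀ {j x y} → ¬ p ∣ j → j * x ≈ j * y → x ≈ y
  *-cancelˡ-≈ {j} {x} {y} p∤j jx≈jy
    with euclid (subst (p ∣_) (sym (*-distribˡ-∣-∣ j x y)) (≈⇒∣∣-∣ (j * x) (j * y) jx≈jy))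
  ... | inj₁ p∣j   = ⊥-elim (p∤j p∣j)
  ... | inj₂ p∣x-y = ∣∣-∣⇒≈ x y p∣x-y

  p^w∣m*n⇒p^w∣m : ∀ w {m n} → ¬ p ∣ n → p ^ w ∣ m * n → p ^ w ∣ m
  p^w∣m*n⇒p^w∣m zero    {m}     _   _ = 1∣ m
  p^w∣m*n⇒p^w∣m (suc w) {m} {n} p∤n p^[1+w]∣mn
    with euclid {m} {n} (∣-trans (m∣m*n (p ^ w)) p^[1+w]∣mn)
  ... | inj₂ p∣n = ⊥-elim (p∤n p∣n)
  ... | inj₁ (divides q refl) =
    subst (p * p ^ w ∣_) (*-comm p q) (*-monoʳ-∣ p (p^w∣m*n⇒p^w∣m w p∤n (*-cancelˡ-∣ p p^w∣qn)))
    where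
    p^w∣qn : p * p ^ w ∣ p * (q * n)
    p^w∣qn = subst (p * p ^ w ∣_) (solve 3 (λ q p n → q :* p :* n := p :* (q :* n)) refl q p n)
                   p^[1+w]∣mn

  -- Since k (n C k) = n ((n - 1) C (k - 1)), a factor p of n C k can only be missing if p ^ w ∣ k.
  p^w∣n⇒p∣nCk : ∀ w {n k} → p ^ w ∣ n → 0 < k → k < p ^ w → p ∣ n C k
  p^w∣n⇒p∣nCk w {zero}  {suc k} _ _ _ rewrite k>n⇒nCk≡0 {0} {suc k} z<s = p ∣0
  p^w∣n⇒p∣nCk w {suc n} {suc k} p^w∣n _ k<p^w with p ∣? (suc n C suc k)
  ... | yes p∣nCk = p∣nCk
  ... | no  p∤nCk = ⊥-elim (<⇒≱ k<p^w (∣⇒≤ (p^w∣m*n⇒p^w∣m w p∤nCk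
          (subst (p ^ w ∣_) (sym ([1+k]*[1+n]C[1+k]≡[1+n]*nCk n k)) (∣m⇒∣m*n (n C k) p^w∣n)))))

  p^w∣s⇒powCoeff≈0 : ∀ w j {s a} → p ^ w ∣ s → 0 < a → a < p ^ w → powCoeff j s a ≈ 0
  p^w∣s⇒powCoeff≈0 w j {s} {a} p^w∣s 0<a a<p^w =
    ∣⇒≈0 (subst (p ∣_) (sym (powCoeff≡C*^ j s a)) (∣m⇒∣m*n _ (p^w∣n⇒p∣nCk w p^w∣s 0<a a<p^w)))

  j^p≈j : ∀ j → j ^ p ≈ j
  j^p≈j zero    = ≈-refl
  j^p≈j (suc j) = begin
    suc j ^ p                                               ≡⟨ sumℕ-powCoeff j p (suc p) ≤-refl ⟨
    sumℕ (powCoeff j p) 0 (suc p)                           ≡⟨ sumℕ-head (powCoeff j p) p ⟩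
    powCoeff j p 0 + sumℕ (λ a → powCoeff j p (suc a)) 0 p  ≡⟨ cong (powCoeff j p 0 +_) (sumℕ-last _ 0 p-1) ⟩
    powCoeff j p 0 + (middle + powCoeff j p p)              ≈⟨ +-cong (≈-trans (≡⇒≈ (powCoeff-zero j p)) (j^p≈j j))
                                                                      (+-cong middle≈0 (≡⇒≈ top)) ⟩
    j + (0 + 1)                                             ≡⟨ +-comm j 1 ⟩
    suc j                                                   ∎
    where
    open ≈-Reasoning
    middle = sumℕ (λ a → powCoeff j p (suc a)) 0 p-1
    middle≈0 : middle ≈ 0
    middle≈0 = ≈-trans (sumℕ-cong-≈ _ (λ _ → 0) 0 p-1 λ a _ a<p-1 →
                          p^w∣s⇒powCoeff≈0 1 j (subst (_∣ p) (sym (*-identityʳ p)) ∣-refl) z<s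
                            (subst (suc a <_) (sym (*-identityʳ p)) (s≤s a<p-1)))
                       (≡⇒≈ (sumℕ-zero _ 0 p-1 (λ _ _ _ → refl)))
    top : powCoeff j p p ≡ 1
    top rewrite powCoeff≡C*^ j p p | nCn≡1 p | n∸n≡0 p = refl

  j^[p-1]≈1 : ∀ {j} → ¬ p ∣ j → j ^ p-1 ≈ 1
  j^[p-1]≈1 {j} p∤j = *-cancelˡ-≈ p∤j (≈-trans (j^p≈j j) (≡⇒≈ (sym (*-identityʳ j))))

  geomCoeff≈0 : ∀ w {M j} → p ^ w ∣ M → j ^ M ≈ 1 → 0 < j → j < p →
                ∀ a → suc a < p ^ w → geomCoeff j M a ≈ 0
  geomCoeff≈0 w {M} {suc zero} p^w∣M _ _ _ a 1+a<p^w = +-cancelˡ-≈ (geomCoeff 1 M (suc a)) (begin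
    G (suc a) + G a            ≡⟨ +-comm (G (suc a)) (G a) ⟩
    G a + G (suc a)            ≡⟨ cong (G a +_) (*-identityˡ (G (suc a))) ⟨
    G a + 1 * G (suc a)        ≡⟨ geomCoeff-suc 1 M a ⟩
    G (suc a) + powCoeff 1 M (suc a)
      ≈⟨ +-cong ≈-refl (p^w∣s⇒powCoeff≈0 w 1 p^w∣M z<s 1+a<p^w) ⟩
    G (suc a) + 0              ∎)
    where
    open ≈-Reasoning
    G = geomCoeff 1 M
  geomCoeff≈0 w {M} {j@(suc (suc j-2))} p^w∣M j^M≈1 _ j<p = vanish
    where
    G = geomCoeff j M
    p∤j-1 : ¬ p ∣ suc j-2
    p∤j-1 = >⇒∤ (<-trans (n<1+n (suc j-2)) j<p)
    cancel : ∀ {x y z} → x ≈ 0 → z ≈ 0 → x + j * y ≈ y + z → y ≈ 0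
    cancel {x} {y} {z} x≈0 z≈0 e = *-cancelˡ-≈ p∤j-1 (begin
      suc j-2 * y               ≈⟨ +-cancelˡ-≈ y (begin
        y + suc j-2 * y           ≈⟨ +-cong x≈0 ≈-refl ⟨
        x + j * y                 ≈⟨ e ⟩
        y + z                     ≈⟨ +-cong ≈-refl z≈0 ⟩
        y + 0                     ∎) ⟩
      0                         ≡⟨ *-zeroʳ (suc j-2) ⟨
      suc j-2 * 0               ∎)
      where open ≈-Reasoning
    vanish : ∀ a → suc a < p ^ w → G a ≈ 0
    vanish zero    _ = cancel ≈-refl ≈-refl (+-cancelˡ-≈ 1 (begin
      1 + (0 + j * G 0)     ≡⟨ +-comm 1 _ ⟩
      j * G 0 + 1           ≡⟨ geomCoeff-zero j M ⟩
      G 0 + powCoeff j M 0  ≈⟨ +-cong ≈-refl (≈-trans (≡⇒≈ (powCoeff-zero j M)) j^M≈1) ⟩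
      G 0 + 1               ≡⟨ +-comm (G 0) 1 ⟩
      1 + G 0               ≡⟨ cong (1 +_) (+-identityʳ (G 0)) ⟨
      1 + (G 0 + 0)         ∎))
      where open ≈-Reasoning
    vanish (suc a) 2+a<p^w = cancel (vanish a 1+a<p^w) (p^w∣s⇒powCoeff≈0 w j p^w∣M z<s 1+a<p^w)
                                    (≡⇒≈ (geomCoeff-suc j M a))
      where 1+a<p^w = <-trans (n<1+n (suc a)) 2+a<p^w

-- The Pascal matrix acting on digit vectors

module PascalAction (b : ℕ) .{{_ : NonZero b}} where

  open Modular b

  pascalApply-suc : ∀ N (v : ℕ → ℕ) a →
                    pascalApply b N v (suc a) ≡ sumℕ (λ r → (r C a) * v (suc r)) 0 N % b
  pascalApply-suc N v a = cong (_% b) (trans (sym dropLeading) (sumℕ-shift f 0 N))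
    where
    f : ℕ → ℕ
    f k = ((k ∸ 1) C a) * v k
    vanishes : ∀ {m} → m ≤ a → ∀ k → 1 ≤ k → k < 1 + m → f k ≡ 0
    vanishes m≤a (suc k) _ (s≤s k<m) rewrite k>n⇒nCk≡0 {k} {a} (<-≤-trans k<m m≤a) = refl
    dropLeading : sumℕ f 1 N ≡ sumℕ f (suc a) (N ∸ a)
    dropLeading with a ≤? N
    ... | yes a≤N = begin
      sumℕ f 1 N                                 ≡⟨ cong (sumℕ f 1) (m+[n∸m]≡n a≤N) ⟨
      sumℕ f 1 (a + (N ∸ a))                     ≡⟨ sumℕ-++ f 1 a (N ∸ a) ⟩
      sumℕ f 1 a + sumℕ f (suc a) (N ∸ a)        ≡⟨ cong (_+ sumℕ f (suc a) (N ∸ a))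
                                                         (sumℕ-zero f 1 a (vanishes ≤-refl)) ⟩
      sumℕ f (suc a) (N ∸ a)                     ∎
      where open ≡-Reasoning
    ... | no a≰N rewrite m≤n⇒m∸n≡0 (<⇒≤ (≰⇒> a≰N)) = sumℕ-zero f 1 N (vanishes (<⇒≤ (≰⇒> a≰N)))

  -- Entry a + 1 of Pʲ v, computed in ℕ from the closed form of the entries of Pʲ.
  pascalPowSum : ℕ → (ℕ → ℕ) → ℕ → ℕ → ℕ
  pascalPowSum N v j a = sumℕ (λ s → v (suc s) * powCoeff j s a) 0 N

  pascalPow≈pascalPowSum : ∀ N v j a →
                           pascalPow b N (suc j) v (suc a) ≈ pascalPowSum N v (suc j) a
  pascalPow≈pascalPowSum N v zero a = mk≈ (begin
    pascalApply b N v (suc a) % b                   ≡⟨ cong (_% b) (pascalApply-suc N v a) ⟩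
    sumℕ (λ r → (r C a) * v (suc r)) 0 N % b % b     ≡⟨ m%n%n≡m%n _ b ⟩
    sumℕ (λ r → (r C a) * v (suc r)) 0 N % b         ≡⟨ cong (_% b) (sumℕ-ext _ _ 0 N λ r →
                                                          trans (*-comm (r C a) (v (suc r)))
                                                                (cong (v (suc r) *_) (sym (powCoeff-one r a)))) ⟩
    pascalPowSum N v 1 a % b                         ∎)
    where open ≡-Reasoning
  pascalPow≈pascalPowSum N v (suc j) a = begin
    pascalPow b N (suc (suc j)) v (suc a)
      ≡⟨ pascalApply-suc N (pascalPow b N (suc j) v) a ⟩
    sumℕ (λ r → (r C a) * pascalPow b N (suc j) v (suc r)) 0 N % b
      ≈⟨ mk≈ (m%n%n≡m%n _ b) ⟩
    sumℕ (λ r → (r C a) * pascalPow b N (suc j) v (suc r)) 0 N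
      ≈⟨ sumℕ-cong-≈ _ _ 0 N (λ r _ _ → *-cong (≈-refl {r C a}) (pascalPow≈pascalPowSum N v j r)) ⟩
    sumℕ (λ r → (r C a) * pascalPowSum N v (suc j) r) 0 N
      ≡⟨ sumℕ-ext _ _ 0 N (λ r → trans (sym (*-distribˡ-sumℕ (r C a) _ 0 N)) (sumℕ-ext _ _ 0 N λ s →
           solve 3 (λ c v q → c :* (v :* q) := v :* (q :* c)) refl
                   (r C a) (v (suc s)) (powCoeff (suc j) s r))) ⟩
    sumℕ (λ r → sumℕ (λ s → v (suc s) * (powCoeff (suc j) s r * (r C a))) 0 N) 0 N
      ≡⟨ sumℕ-comm (λ r s → v (suc s) * (powCoeff (suc j) s r * (r C a))) 0 N 0 N ⟩
    sumℕ (λ s → sumℕ (λ r → v (suc s) * (powCoeff (suc j) s r * (r C a))) 0 N) 0 N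
      ≡⟨ sumℕ-cong _ _ 0 N (λ s _ s<N → trans (*-distribˡ-sumℕ (v (suc s)) _ 0 N)
           (cong (v (suc s) *_) (sumℕ-powCoeff*C (suc j) s N a s<N))) ⟩
    pascalPowSum N v (suc (suc j)) a ∎
    where open ≈-Reasoning

  pascalPow<b : ∀ N v j k → pascalPow b N (suc j) v k < b
  pascalPow<b N v j k = m%n<n _ b

module PowerMinusBaseDigits (b-1 : ℕ) where

  b : ℕ
  b = suc b-1

  digitVec-high : ∀ n s → n < b ^ s → digitVec b n (suc s) ≡ 0
  digitVec-high n s n<b^s = cong (_% b) (m<n⇒m/n≡0 {{m^n≢0 b s}} n<b^s)

  digitVec-one : ∀ M → 1 ≤ M → digitVec b (b ^ M ∸ b) 1 ≡ 0
  digitVec-one (suc M) _ = begin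
    (b ^ suc M ∸ b) / 1 % b      ≡⟨ cong (_% b) (n/1≡n (b ^ suc M ∸ b)) ⟩
    (b ^ suc M ∸ b) % b          ≡⟨ cong (_% b) (cong₂ _∸_ (*-comm b (b ^ M)) (sym (*-identityˡ b))) ⟩
    (b ^ M * b ∸ 1 * b) % b      ≡⟨ cong (_% b) (*-distribʳ-∸ b (b ^ M) 1) ⟨
    (b ^ M ∸ 1) * b % b          ≡⟨ m*n%n≡0 (b ^ M ∸ 1) b ⟩
    0                            ∎
    where open ≡-Reasoning

  -- With d = b (y + 1) and e = b (x + 1): d e - b = (e - 1) d + (d - b), where d - b < d.
  [d*e∸b]/d%b≡b-1 : ∀ x y → ((b * suc y * (b * suc x) ∸ b) / (b * suc y)) % b ≡ b-1
  [d*e∸b]/d%b≡b-1 x y = begin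
    ((b * suc y * (b * suc x) ∸ b) / d) % b   ≡⟨ cong (λ t → ((t ∸ b) / d) % b) expand ⟩
    (((q * d + r) + b ∸ b) / d) % b           ≡⟨ cong (λ t → (t / d) % b) (m+n∸n≡m (q * d + r) b) ⟩
    ((q * d + r) / d) % b                     ≡⟨ cong (_% b) (+-distrib-/ (q * d) r remainders<d) ⟩
    ((q * d) / d + r / d) % b                 ≡⟨ cong₂ (λ s t → (s + t) % b) (m*n/n≡m q d) (m<n⇒m/n≡0 r<d) ⟩
    (q + 0) % b                               ≡⟨ cong (_% b) (+-identityʳ q) ⟩
    (b-1 + x * b) % b                         ≡⟨ [m+kn]%n≡m%n b-1 x b ⟩
    b-1 % b                                   ≡⟨ m<n⇒m%n≡m (n<1+n b-1) ⟩
    b-1                                       ∎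
    where
    open ≡-Reasoning
    d = b * suc y
    q = b-1 + x * b
    r = b * y
    expand : b * suc y * (b * suc x) ≡ (q * d + r) + b
    expand = solve 3 (λ P X Y →
      (con 1 :+ P) :* (con 1 :+ Y) :* ((con 1 :+ P) :* (con 1 :+ X))
        := ((P :+ X :* (con 1 :+ P)) :* ((con 1 :+ P) :* (con 1 :+ Y)) :+ (con 1 :+ P) :* Y) :+ (con 1 :+ P))
      refl b-1 x y
    r<d : r < d
    r<d = *-monoʳ-< b (n<1+n y)
    remainders<d : (q * d) % d + r % d < d
    remainders<d = subst (_< d) (sym (cong₂ _+_ (m*n%n≡0 q d) (m<n⇒m%n≡m r<d))) r<d

  digitVec-mid : ∀ M s → 1 ≤ s → s < M → digitVec b (b ^ M ∸ b) (suc s) ≡ b-1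
  digitVec-mid M (suc s) _ s<M with m≤n⇒∃[o]m+o≡n s<M
  ... | k , refl = begin
    ((b ^ (2 + s + k) ∸ b) / b ^ suc s) {{m^n≢0 b (suc s)}} % b
      ≡⟨ cong (λ t → ((t ∸ b) / b ^ suc s) {{m^n≢0 b (suc s)}} % b)
              (trans (cong (b ^_) (sym (+-suc (suc s) k))) (^-distribˡ-+-* b (suc s) (suc k))) ⟩
    ((b ^ suc s * b ^ suc k ∸ b) / b ^ suc s) {{m^n≢0 b (suc s)}} % b
      ≡⟨ digit (b ^ s) (b ^ k) {{m^n≢0 b s}} {{m^n≢0 b k}} ⟩
    b-1 ∎
    where
    open ≡-Reasoning
    digit : ∀ Y X .{{_ : NonZero Y}} .{{_ : NonZero X}} →
            ((b * Y * (b * X) ∸ b) / (b * Y)) {{m*n≢0 b Y}} % b ≡ b-1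
    digit (suc y) (suc x) = [d*e∸b]/d%b≡b-1 x y

m+b≤b^m : ∀ b-2 m → 2 ≤ m → m + suc (suc b-2) ≤ suc (suc b-2) ^ m
m+b≤b^m b-2 (suc zero) (s≤s ())
m+b≤b^m b-2 (suc (suc zero)) _ = subst (2 + b ≤_) square (m≤m+n (2 + b) (3 * b-2 + b-2 * b-2))
  where
  b = suc (suc b-2)
  square : 2 + b + (3 * b-2 + b-2 * b-2) ≡ b ^ 2
  square = solve 1 (λ x → (con 4 :+ x) :+ (con 3 :* x :+ x :* x) := (con 2 :+ x) :* ((con 2 :+ x) :* con 1))
                   refl b-2
m+b≤b^m b-2 (suc (suc (suc m))) _ = begin
  1 + (suc (suc m) + b)  ≤⟨ +-mono-≤ (m^n>0 b (suc (suc m))) (m+b≤b^m b-2 (suc (suc m)) (s≤s (s≤s z≤n))) ⟩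
  B + B                  ≤⟨ +-monoʳ-≤ B (m≤n*m B (suc b-2)) ⟩
  B + suc b-2 * B        ∎
  where
  open ≤-Reasoning
  b = suc (suc b-2)
  B = b ^ suc (suc m)

-- Rational numbers

infixl 7 _/ℕ_
_/ℕ_ : ℕ → (q : ℕ) → .{{NonZero q}} → ℚ
a /ℕ q = ℤ.+ a ℚ./ q

private
  toℚᵘ-/ℕ : ∀ a q-1 → ℚ.toℚᵘ (a /ℕ suc q-1) ℚᵘ.≃ mkℚᵘ (ℤ.+ a) q-1
  toℚᵘ-/ℕ a q-1 = ℚₚ.toℚᵘ-fromℚᵘ (mkℚᵘ (ℤ.+ a) q-1)

/ℕ-≡ : ∀ a q c q′ .{{_ : NonZero q}} .{{_ : NonZero q′}} → a * q′ ≡ c * q → a /ℕ q ≡ c /ℕ q′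
/ℕ-≡ a (suc q-1) c (suc q′-1) e = ℚₚ.fromℚᵘ-cong {mkℚᵘ (ℤ.+ a) q-1} {mkℚᵘ (ℤ.+ c) q′-1}
  (*≡* (trans (sym (ℤₚ.pos-* a (suc q′-1))) (trans (cong ℤ.+_ e) (ℤₚ.pos-* c (suc q-1)))))

/ℕ-mono-≤ : ∀ a q c q′ .{{_ : NonZero q}} .{{_ : NonZero q′}} → a * q′ ≤ c * q → a /ℕ q ℚ.≤ c /ℕ q′
/ℕ-mono-≤ a (suc q-1) c (suc q′-1) le = ℚₚ.toℚᵘ-cancel-≤
  (ℚᵘₚ.≤-respˡ-≃ (ℚᵘₚ.≃-sym (toℚᵘ-/ℕ a q-1))
    (ℚᵘₚ.≤-respʳ-≃ (ℚᵘₚ.≃-sym (toℚᵘ-/ℕ c q′-1))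
      (*≤* (subst₂ ℤ._≤_ (ℤₚ.pos-* a (suc q′-1)) (ℤₚ.pos-* c (suc q-1)) (+≤+ le)))))

/ℕ-mono-< : ∀ a q c q′ .{{_ : NonZero q}} .{{_ : NonZero q′}} → a * q′ < c * q → a /ℕ q ℚ.< c /ℕ q′
/ℕ-mono-< a (suc q-1) c (suc q′-1) lt = ℚₚ.toℚᵘ-cancel-<
  (ℚᵘₚ.<-respˡ-≃ (ℚᵘₚ.≃-sym (toℚᵘ-/ℕ a q-1))
    (ℚᵘₚ.<-respʳ-≃ (ℚᵘₚ.≃-sym (toℚᵘ-/ℕ c q′-1))
      (*<* (subst₂ ℤ._<_ (ℤₚ.pos-* a (suc q′-1)) (ℤₚ.pos-* c (suc q-1)) (+<+ lt)))))

/ℕ-+ : ∀ a q c q′ .{{_ : NonZero q}} .{{_ : NonZero q′}} →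
       a /ℕ q ℚ.+ c /ℕ q′ ≡ ((a * q′ + c * q) /ℕ (q * q′)) {{m*n≢0 q q′}}
/ℕ-+ a (suc q-1) c (suc q′-1) = ℚₚ.toℚᵘ-injective (begin
  ℚ.toℚᵘ (a /ℕ q ℚ.+ c /ℕ q′)
    ≈⟨ ℚₚ.toℚᵘ-homo-+ (a /ℕ q) (c /ℕ q′) ⟩
  ℚ.toℚᵘ (a /ℕ q) ℚᵘ.+ ℚ.toℚᵘ (c /ℕ q′)
    ≈⟨ ℚᵘₚ.+-cong (toℚᵘ-/ℕ a q-1) (toℚᵘ-/ℕ c q′-1) ⟩
  mkℚᵘ (ℤ.+ a) q-1 ℚᵘ.+ mkℚᵘ (ℤ.+ c) q′-1
    ≡⟨ cong (λ z → mkℚᵘ z (q′-1 + q-1 * q′))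
            (trans (cong₂ ℤ._+_ (sym (ℤₚ.pos-* a q′)) (sym (ℤₚ.pos-* c q)))
                   (sym (ℤₚ.pos-+ (a * q′) (c * q)))) ⟩
  mkℚᵘ (ℤ.+ (a * q′ + c * q)) (q′-1 + q-1 * q′)
    ≈⟨ toℚᵘ-/ℕ (a * q′ + c * q) (q′-1 + q-1 * q′) ⟨
  ℚ.toℚᵘ ((a * q′ + c * q) /ℕ (q * q′)) ∎)
  where
  open ℚᵘₚ.≃-Reasoning
  q  = suc q-1
  q′ = suc q′-1

/ℕ-* : ∀ a q c q′ .{{_ : NonZero q}} .{{_ : NonZero q′}} →
       (a /ℕ q) ℚ.* (c /ℕ q′) ≡ ((a * c) /ℕ (q * q′)) {{m*n≢0 q q′}}
/ℕ-* a (suc q-1) c (suc q′-1) = ℚₚ.toℚᵘ-injective (begin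
  ℚ.toℚᵘ ((a /ℕ q) ℚ.* (c /ℕ q′))
    ≈⟨ ℚₚ.toℚᵘ-homo-* (a /ℕ q) (c /ℕ q′) ⟩
  ℚ.toℚᵘ (a /ℕ q) ℚᵘ.* ℚ.toℚᵘ (c /ℕ q′)
    ≈⟨ ℚᵘₚ.*-cong (toℚᵘ-/ℕ a q-1) (toℚᵘ-/ℕ c q′-1) ⟩
  mkℚᵘ (ℤ.+ a) q-1 ℚᵘ.* mkℚᵘ (ℤ.+ c) q′-1
    ≡⟨ cong (λ z → mkℚᵘ z (q′-1 + q-1 * q′)) (sym (ℤₚ.pos-* a c)) ⟩
  mkℚᵘ (ℤ.+ (a * c)) (q′-1 + q-1 * q′)
    ≈⟨ toℚᵘ-/ℕ (a * c) (q′-1 + q-1 * q′) ⟨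
  ℚ.toℚᵘ ((a * c) /ℕ (q * q′)) ∎)
  where
  open ℚᵘₚ.≃-Reasoning
  q  = suc q-1
  q′ = suc q′-1

0≤/ℕ : ∀ a q .{{_ : NonZero q}} → 0ℚ ℚ.≤ a /ℕ q
0≤/ℕ a q = /ℕ-mono-≤ 0 1 a q z≤n

0</ℕ : ∀ a q .{{_ : NonZero q}} → 0 < a → 0ℚ ℚ.< a /ℕ q
0</ℕ (suc a) q _ = /ℕ-mono-< 0 1 (suc a) q z<s

sumℚ-++ : ∀ (f : ℕ → ℚ) lo x y → sumℚ f lo (x + y) ≡ sumℚ f lo x ℚ.+ sumℚ f (lo + x) y
sumℚ-++ f lo zero    y = trans (cong (λ l → sumℚ f l y) (sym (+-identityʳ lo))) (sym (ℚₚ.+-identityˡ _))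
sumℚ-++ f lo (suc x) y rewrite sumℚ-++ f (suc lo) x y | +-suc lo x = sym (ℚₚ.+-assoc (f lo) _ _)

sumℚ-zero : ∀ (f : ℕ → ℚ) lo len → (∀ k → lo ≤ k → k < lo + len → f k ≡ 0ℚ) → sumℚ f lo len ≡ 0ℚ
sumℚ-zero f lo zero      _   = refl
sumℚ-zero f lo (suc len) f≡0 = begin
  f lo ℚ.+ sumℚ f (suc lo) len  ≡⟨ cong₂ ℚ._+_ (f≡0 lo ≤-refl (m<m+n lo z<s))
                                     (sumℚ-zero f (suc lo) len λ k lo<k k<end →
                                        f≡0 k (<⇒≤ lo<k) (subst (k <_) (sym (+-suc lo len)) k<end)) ⟩
  0ℚ ℚ.+ 0ℚ                     ≡⟨ ℚₚ.+-identityʳ 0ℚ ⟩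
  0ℚ                            ∎
  where open ≡-Reasoning

sumℚ-nonNeg : ∀ (f : ℕ → ℚ) lo len → (∀ k → 0ℚ ℚ.≤ f k) → 0ℚ ℚ.≤ sumℚ f lo len
sumℚ-nonNeg f lo zero      _     = ℚₚ.≤-refl
sumℚ-nonNeg f lo (suc len) 0≤f =
  subst (ℚ._≤ f lo ℚ.+ sumℚ f (suc lo) len) (ℚₚ.+-identityʳ 0ℚ)
        (ℚₚ.+-mono-≤ (0≤f lo) (sumℚ-nonNeg f (suc lo) len 0≤f))

distInf≤ : ∀ {d} (x y : Fin d → ℚ) c → 0ℚ ℚ.≤ c → (∀ j → ℚ.∣ x j ℚ.- y j ∣ ℚ.≤ c) →
           distInf x y ℚ.≤ c
distInf≤ {d} x y c 0≤c bound = foldr-⊔≤ (allFin d)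
  where
  foldr-⊔≤ : ∀ js → foldr ℚ._⊔_ 0ℚ (map (λ j → ℚ.∣ x j ℚ.- y j ∣) js) ℚ.≤ c
  foldr-⊔≤ []       = 0≤c
  foldr-⊔≤ (j ∷ js) = ℚₚ.⊔-lub (bound j) (foldr-⊔≤ js)

∣x-[x+t]∣≤u : ∀ x t u → 0ℚ ℚ.≤ t → t ℚ.≤ u → ℚ.∣ x ℚ.- (x ℚ.+ t) ∣ ℚ.≤ u
∣x-[x+t]∣≤u x t u 0≤t t≤u = subst (ℚ._≤ u) (sym ∣x-[x+t]∣≡t) t≤u
  where
  ∣x-[x+t]∣≡t : ℚ.∣ x ℚ.- (x ℚ.+ t) ∣ ≡ t
  ∣x-[x+t]∣≡t = begin
    ℚ.∣ x ℚ.- (x ℚ.+ t) ∣  ≡⟨ cong ℚ.∣_∣ (ℚsolve 2 (λ x t → x ℚ:- (x ℚ:+ t) ℚ:= ℚ:- t) refl x t) ⟩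
    ℚ.∣ ℚ.- t ∣             ≡⟨ ℚₚ.∣-p∣≡∣p∣ t ⟩
    ℚ.∣ t ∣                 ≡⟨ ℚₚ.0≤p⇒∣p∣≡p 0≤t ⟩
    t                       ∎
    where open ≡-Reasoning

module _ {x y t u : ℚ} (y+u≡x : y ℚ.+ u ≡ x) (0≤t : 0ℚ ℚ.≤ t) (t<u : t ℚ.< u) where

  private
    x-[y+t]≡u-t : x ℚ.- (y ℚ.+ t) ≡ u ℚ.- t
    x-[y+t]≡u-t = trans (cong (ℚ._- (y ℚ.+ t)) (sym y+u≡x))
                        (ℚsolve 3 (λ y u t → (y ℚ:+ u) ℚ:- (y ℚ:+ t) ℚ:= u ℚ:- t) refl y u t)

    0<u-t : 0ℚ ℚ.< u ℚ.- t
    0<u-t = subst (ℚ._< u ℚ.- t) (ℚₚ.+-inverseʳ t) (ℚₚ.+-monoˡ-< (ℚ.- t) t<u)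

  ∣x-[y+t]∣≤u : ℚ.∣ x ℚ.- (y ℚ.+ t) ∣ ℚ.≤ u
  ∣x-[y+t]∣≤u = begin
    ℚ.∣ x ℚ.- (y ℚ.+ t) ∣   ≡⟨ cong ℚ.∣_∣ x-[y+t]≡u-t ⟩
    ℚ.∣ u ℚ.- t ∣           ≡⟨ ℚₚ.0≤p⇒∣p∣≡p (ℚₚ.<⇒≤ 0<u-t) ⟩
    u ℚ.- t                 ≤⟨ ℚₚ.+-monoʳ-≤ u (ℚₚ.neg-antimono-≤ 0≤t) ⟩
    u ℚ.+ ℚ.- 0ℚ            ≡⟨ ℚₚ.+-identityʳ u ⟩
    u                       ∎
    where open ℚₚ.≤-Reasoning

  x≢y+t : x ≢ y ℚ.+ t
  x≢y+t x≡y+t =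
    ℚₚ.<-irrefl (trans (sym (ℚₚ.+-inverseʳ x)) (trans (cong (λ z → x ℚ.- z) x≡y+t) x-[y+t]≡u-t)) 0<u-t

module RadixExpansion (b-1 : ℕ) where

  b : ℕ
  b = suc b-1

  placeValue : ℕ → ℚ
  placeValue k = (1 /ℕ b ^ k) {{m^n≢0 b k}}

  digitValue : (ℕ → ℕ) → ℕ → ℚ
  digitValue D k = (D k /ℕ b ^ k) {{m^n≢0 b k}}

  0≤digitValue : ∀ D k → 0ℚ ℚ.≤ digitValue D k
  0≤digitValue D k = 0≤/ℕ (D k) (b ^ k) {{m^n≢0 b k}}

  private
    carry : ∀ d l → (d /ℕ b ^ suc l) {{m^n≢0 b (suc l)}} ℚ.+ placeValue (suc l)
                  ≡ (suc d /ℕ b ^ suc l) {{m^n≢0 b (suc l)}}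
    carry d l = trans (/ℕ-+ d q 1 q {{q≢0}} {{q≢0}})
                      (/ℕ-≡ (d * q + 1 * q) (q * q) (suc d) q {{m*n≢0 q q {{q≢0}} {{q≢0}}}} {{q≢0}}
                            (solve 2 (λ d q → (d :* q :+ con 1 :* q) :* q := (con 1 :+ d) :* (q :* q)) refl d q))
      where
      q = b ^ suc l
      q≢0 = m^n≢0 b (suc l)

  digit+placeValue≤placeValue : ∀ d l → d < b →
    (d /ℕ b ^ suc l) {{m^n≢0 b (suc l)}} ℚ.+ placeValue (suc l) ℚ.≤ placeValue l
  digit+placeValue≤placeValue d l d<b = ℚₚ.≤-trans (ℚₚ.≤-reflexive (carry d l))
    (/ℕ-mono-≤ (suc d) (b ^ suc l) 1 (b ^ l) {{m^n≢0 b (suc l)}} {{m^n≢0 b l}}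
      (subst (suc d * b ^ l ≤_) (sym (*-identityˡ (b ^ suc l))) (*-monoˡ-≤ (b ^ l) d<b)))

  maxDigit+placeValue≡placeValue : ∀ l →
    (b-1 /ℕ b ^ suc l) {{m^n≢0 b (suc l)}} ℚ.+ placeValue (suc l) ≡ placeValue l
  maxDigit+placeValue≡placeValue l = trans (carry b-1 l)
    (/ℕ-≡ b (b ^ suc l) 1 (b ^ l) {{m^n≢0 b (suc l)}} {{m^n≢0 b l}} (sym (*-identityˡ (b ^ suc l))))

  sumℚ-digitValue-bound : ∀ D → (∀ k → D k < b) → ∀ len l →
    sumℚ (digitValue D) (suc l) len ℚ.+ placeValue (l + len) ℚ.≤ placeValue l
  sumℚ-digitValue-bound D D<b zero l =
    ℚₚ.≤-reflexive (trans (ℚₚ.+-identityˡ _) (cong placeValue (+-identityʳ l)))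
  sumℚ-digitValue-bound D D<b (suc len) l = begin
    (digitValue D (suc l) ℚ.+ sumℚ (digitValue D) (suc (suc l)) len) ℚ.+ placeValue (l + suc len)
      ≡⟨ ℚₚ.+-assoc (digitValue D (suc l)) _ _ ⟩
    digitValue D (suc l) ℚ.+ (sumℚ (digitValue D) (suc (suc l)) len ℚ.+ placeValue (l + suc len))
      ≡⟨ cong (λ z → digitValue D (suc l) ℚ.+ (sumℚ (digitValue D) (suc (suc l)) len ℚ.+ placeValue z))
              (+-suc l len) ⟩
    digitValue D (suc l) ℚ.+ (sumℚ (digitValue D) (suc (suc l)) len ℚ.+ placeValue (suc l + len))
      ≤⟨ ℚₚ.+-monoʳ-≤ (digitValue D (suc l)) (sumℚ-digitValue-bound D D<b len (suc l)) ⟩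
    digitValue D (suc l) ℚ.+ placeValue (suc l)
      ≤⟨ digit+placeValue≤placeValue (D (suc l)) l (D<b (suc l)) ⟩
    placeValue l ∎
    where open ℚₚ.≤-Reasoning

  sumℚ-maxDigits : ∀ D len l → (∀ k → suc l ≤ k → k < suc l + len → D k ≡ b-1) →
    sumℚ (digitValue D) (suc l) len ℚ.+ placeValue (l + len) ≡ placeValue l
  sumℚ-maxDigits D zero l _ = trans (ℚₚ.+-identityˡ _) (cong placeValue (+-identityʳ l))
  sumℚ-maxDigits D (suc len) l D≡b-1 = begin
    (digitValue D (suc l) ℚ.+ sumℚ (digitValue D) (suc (suc l)) len) ℚ.+ placeValue (l + suc len)
      ≡⟨ ℚₚ.+-assoc (digitValue D (suc l)) _ _ ⟩
    digitValue D (suc l) ℚ.+ (sumℚ (digitValue D) (suc (suc l)) len ℚ.+ placeValue (l + suc len))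
      ≡⟨ cong (λ z → digitValue D (suc l) ℚ.+ (sumℚ (digitValue D) (suc (suc l)) len ℚ.+ placeValue z))
              (+-suc l len) ⟩
    digitValue D (suc l) ℚ.+ (sumℚ (digitValue D) (suc (suc l)) len ℚ.+ placeValue (suc l + len))
      ≡⟨ cong (digitValue D (suc l) ℚ.+_) (sumℚ-maxDigits D len (suc l) λ k l<k k<end →
           D≡b-1 k (<⇒≤ l<k) (subst (k <_) (sym (+-suc (suc l) len)) k<end)) ⟩
    digitValue D (suc l) ℚ.+ placeValue (suc l)
      ≡⟨ cong (λ d → (d /ℕ b ^ suc l) {{m^n≢0 b (suc l)}} ℚ.+ placeValue (suc l))
              (D≡b-1 (suc l) ≤-refl (m<m+n (suc l) z<s)) ⟩
    (b-1 /ℕ b ^ suc l) {{m^n≢0 b (suc l)}} ℚ.+ placeValue (suc l)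
      ≡⟨ maxDigit+placeValue≡placeValue l ⟩
    placeValue l ∎
    where open ≡-Reasoning

0≤powℚ : ∀ e {x} → 0ℚ ℚ.≤ x → 0ℚ ℚ.≤ powℚ x e
0≤powℚ zero    _   = 0≤/ℕ 1 1
0≤powℚ (suc e) {x} 0≤x =
  subst (ℚ._≤ x ℚ.* powℚ x e) (ℚₚ.*-zeroʳ x)
        (ℚₚ.*-monoˡ-≤-nonNeg x {{ℚ.nonNegative 0≤x}} (0≤powℚ e 0≤x))

powℚ-mono-< : ∀ e {x y} → 0ℚ ℚ.≤ x → x ℚ.< y → powℚ x (suc e) ℚ.< powℚ y (suc e)
powℚ-mono-< zero    {x} {y} _   x<y = subst₂ ℚ._<_ (sym (ℚₚ.*-identityʳ x)) (sym (ℚₚ.*-identityʳ y)) x<y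
powℚ-mono-< (suc e) {x} {y} 0≤x x<y =
  ℚₚ.≤-<-trans (ℚₚ.*-monoˡ-≤-nonNeg x {{ℚ.nonNegative 0≤x}} (ℚₚ.<⇒≤ xᵉ<yᵉ))
               (ℚₚ.*-monoˡ-<-pos (powℚ y (suc e)) {{ℚ.positive 0<yᵉ}} x<y)
  where
  xᵉ<yᵉ = powℚ-mono-< e 0≤x x<y
  0<yᵉ : 0ℚ ℚ.< powℚ y (suc e)
  0<yᵉ = ℚₚ.≤-<-trans (0≤powℚ (suc e) 0≤x) xᵉ<yᵉ

powℚ-1/ℕ : ∀ q e .{{_ : NonZero q}} → powℚ (1 /ℕ q) e ≡ (1 /ℕ q ^ e) {{m^n≢0 q e}}
powℚ-1/ℕ q zero    = refl
powℚ-1/ℕ q (suc e) {{q≢0}} =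
  trans (cong ((1 /ℕ q) ℚ.*_) (powℚ-1/ℕ q e)) (/ℕ-* 1 q 1 (q ^ e) {{q≢0}} {{m^n≢0 q e}})

-- The points x₁ and xₙ of the theorem

module PascalPowersAtN (b-2 w-1 : ℕ) (isPrime : Prime (suc (suc b-2))) where

  b-1 b w K M n : ℕ
  b-1 = suc b-2
  b   = suc b-1
  w   = suc w-1
  K   = b ^ w
  M   = b-1 * K
  n   = b ^ M ∸ b

  V : ℕ → ℕ
  V = digitVec b n

  open PrimeModulus b-1 isPrime
  open PascalAction b
  open PowerMinusBaseDigits b-1 hiding (b)

  b≤K : b ≤ K
  b≤K = m≤m*n b (b ^ w-1) {{m^n≢0 b w-1}}

  K≤M : K ≤ M
  K≤M = m≤n*m K b-1

  2≤M : 2 ≤ M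
  2≤M = ≤-trans (s≤s (s≤s z≤n)) (≤-trans b≤K K≤M)

  M≤n : M ≤ n
  M≤n = m+n≤o⇒m≤o∸n M (m+b≤b^m b-2 M 2≤M)

  b≤b^M : b ≤ b ^ M
  b≤b^M = subst (_≤ b ^ M) (*-identityʳ b) (^-monoʳ-≤ b (≤-trans (s≤s z≤n) 2≤M))

  n<b^M : n < b ^ M
  n<b^M = ∸-monoʳ-< {b ^ M} {b} {0} z<s b≤b^M

  V-mid : ∀ s → 1 ≤ s → s < M → V (suc s) ≡ b-1
  V-mid = digitVec-mid M

  V-high : ∀ s → M ≤ s → V (suc s) ≡ 0
  V-high s M≤s = digitVec-high n s (<-≤-trans n<b^M (^-monoʳ-≤ b M≤s))

  V<b : ∀ k → V k < b
  V<b k = m%n<n ((n / b ^ (k ∸ 1)) {{m^n≢0 b (k ∸ 1)}}) b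

  -- Since V = (b - 1)(e₂ + ⋯ + e_M), entry a + 1 of Pʲ V is (b - 1) Σ_{1≤s<M} powCoeff j s a.
  pascalPowSum-V : ∀ j a → pascalPowSum n V j a + b-1 * powCoeff j 0 a ≡ b-1 * geomCoeff j M a
  pascalPowSum-V j a with m≤n⇒∃[o]m+o≡n 2≤M
  ... | M-2 , 2+M-2≡M = begin
    sumℕ f 0 n + b-1 * Q₀
      ≡⟨ cong (λ x → sumℕ f 0 x + b-1 * Q₀) (m+[n∸m]≡n M≤n) ⟨
    sumℕ f 0 (M + (n ∸ M)) + b-1 * Q₀
      ≡⟨ cong (_+ b-1 * Q₀) (sumℕ-++ f 0 M (n ∸ M)) ⟩
    (sumℕ f 0 M + sumℕ f M (n ∸ M)) + b-1 * Q₀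
      ≡⟨ cong (λ x → (sumℕ f 0 M + x) + b-1 * Q₀) (sumℕ-zero f M (n ∸ M) high) ⟩
    (sumℕ f 0 M + 0) + b-1 * Q₀
      ≡⟨ cong (λ x → (sumℕ f 0 x + 0) + b-1 * Q₀) M≡ ⟩
    (f 0 + sumℕ f 1 (suc M-2) + 0) + b-1 * Q₀
      ≡⟨ cong (λ x → (x * Q₀ + sumℕ f 1 (suc M-2) + 0) + b-1 * Q₀)
              (digitVec-one M (≤-trans (s≤s z≤n) 2≤M)) ⟩
    (0 + sumℕ f 1 (suc M-2) + 0) + b-1 * Q₀
      ≡⟨ cong (λ x → (0 + x + 0) + b-1 * Q₀) mid ⟩
    (0 + b-1 * T + 0) + b-1 * Q₀
      ≡⟨ solve 3 (λ d t q → (con 0 :+ d :* t :+ con 0) :+ d :* q := d :* (q :+ t)) refl b-1 T Q₀ ⟩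
    b-1 * sumℕ (λ s → powCoeff j s a) 0 (suc (suc M-2))
      ≡⟨ cong (λ x → b-1 * geomCoeff j x a) M≡ ⟨
    b-1 * geomCoeff j M a ∎
    where
    open ≡-Reasoning
    f : ℕ → ℕ
    f s = V (suc s) * powCoeff j s a
    Q₀ = powCoeff j 0 a
    T = sumℕ (λ s → powCoeff j s a) 1 (suc M-2)
    M≡ : M ≡ suc (suc M-2)
    M≡ = sym 2+M-2≡M
    high : ∀ s → M ≤ s → s < M + (n ∸ M) → f s ≡ 0
    high s M≤s _ = cong (_* powCoeff j s a) (V-high s M≤s)
    mid : sumℕ f 1 (suc M-2) ≡ b-1 * T
    mid = trans (sumℕ-cong f (λ s → b-1 * powCoeff j s a) 1 (suc M-2) λ s 1≤s s<M →
                   cong (_* powCoeff j s a) (V-mid s 1≤s (subst (s <_) (sym M≡) s<M)))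
                (*-distribˡ-sumℕ b-1 (λ s → powCoeff j s a) 1 (suc M-2))

  j^M≈1 : ∀ {j} → 0 < j → j < b → j ^ M ≈ 1
  j^M≈1 {j} 0<j j<b = begin
    j ^ (b-1 * K)     ≡⟨ ^-*-assoc j b-1 K ⟨
    (j ^ b-1) ^ K     ≈⟨ ^-cong K (j^[p-1]≈1 (>⇒∤ {{ℕ.>-nonZero 0<j}} j<b)) ⟩
    1 ^ K             ≡⟨ ^-zeroˡ K ⟩
    1                 ∎
    where open ≈-Reasoning

  pascalPowSum-V≈0 : ∀ j a → suc j < b → suc a < K →
                     pascalPowSum n V (suc j) a + b-1 * powCoeff (suc j) 0 a ≈ 0
  pascalPowSum-V≈0 j a 1+j<b 1+a<K = begin
    pascalPowSum n V (suc j) a + b-1 * powCoeff (suc j) 0 a  ≡⟨ pascalPowSum-V (suc j) a ⟩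
    b-1 * geomCoeff (suc j) M a                              ≈⟨ *-cong (≈-refl {b-1}) G≈0 ⟩
    b-1 * 0                                                  ≡⟨ *-zeroʳ b-1 ⟩
    0                                                        ∎
    where
    open ≈-Reasoning
    G≈0 = geomCoeff≈0 w (n∣m*n b-1) (j^M≈1 z<s 1+j<b) z<s 1+j<b a 1+a<K

  private
    reduced : ∀ j k → pascalPow b n (suc j) V k ≡ pascalPow b n (suc j) V k % b
    reduced j k = sym (m<n⇒m%n≡m (pascalPow<b n V j k))

  -- The leading digit: b - 1 ≡ -1 (mod b) turns "≈ 0" into "≈ 1".
  pascalPow-V-one : ∀ j → suc j < b → pascalPow b n (suc j) V 1 ≡ 1
  pascalPow-V-one j 1+j<b = trans (reduced j 1) (un≈ (≈-trans (pascalPow≈pascalPowSum n V j 0) E≈1))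
    where
    E = pascalPowSum n V (suc j) 0
    E≈1 : E ≈ 1
    E≈1 = +-cancelˡ-≈ b-1 (begin
      b-1 + E               ≡⟨ +-comm b-1 E ⟩
      E + b-1               ≡⟨ cong (E +_) (*-identityʳ b-1) ⟨
      E + b-1 * 1           ≈⟨ pascalPowSum-V≈0 j 0 1+j<b (<-≤-trans (s≤s (s≤s z≤n)) b≤K) ⟩
      0                     ≈⟨ ∣⇒≈0 ∣-refl ⟨
      b                     ≡⟨ +-comm 1 b-1 ⟩
      b-1 + 1               ∎)
      where open ≈-Reasoning

  pascalPow-V-low : ∀ j a → suc j < b → 2 + a < K → pascalPow b n (suc j) V (2 + a) ≡ 0
  pascalPow-V-low j a 1+j<b 2+a<K = trans (reduced j (2 + a)) (un≈ (begin
    pascalPow b n (suc j) V (2 + a)       ≈⟨ pascalPow≈pascalPowSum n V j (suc a) ⟩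
    E                                     ≡⟨ +-identityʳ E ⟨
    E + 0                                 ≡⟨ cong (E +_) (*-zeroʳ b-1) ⟨
    E + b-1 * powCoeff (suc j) 0 (suc a)  ≈⟨ pascalPowSum-V≈0 j (suc a) 1+j<b 2+a<K ⟩
    0                                     ∎))
    where
    open ≈-Reasoning
    E = pascalPowSum n V (suc j) (suc a)

  pascalPow-e₁ : ∀ j → pascalPow b 1 j (digitVec b 1) 1 ≡ 1
  pascalPow-e₁ zero = refl
  pascalPow-e₁ (suc j) rewrite pascalPow-e₁ j = refl

module FaurePoints (b-2 w-1 : ℕ) (isPrime : Prime (suc (suc b-2))) where

  open PascalPowersAtN b-2 w-1 isPrime
  open PascalAction b using (pascalPow<b)
  open PowerMinusBaseDigits b-1 using (digitVec-one)
  open RadixExpansion b-1 hiding (b)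

  K-2 L R : ℕ
  K-2 = K ∸ 2
  L   = K ∸ 1
  R   = n ∸ L

  K≡2+K-2 : K ≡ 2 + K-2
  K≡2+K-2 = sym (m+[n∸m]≡n (≤-trans (s≤s (s≤s z≤n)) b≤K))

  L≡1+K-2 : L ≡ suc K-2
  L≡1+K-2 = cong (_∸ 1) K≡2+K-2

  L≤n : L ≤ n
  L≤n = ≤-trans (m∸n≤m K 1) (≤-trans K≤M M≤n)

  tail : (ℕ → ℕ) → ℚ
  tail D = sumℚ (digitValue D) (suc L) R

  split : ∀ D → sumℚ (digitValue D) 1 n
              ≡ (digitValue D 1 ℚ.+ sumℚ (digitValue D) 2 K-2) ℚ.+ tail D
  split D = begin
    sumℚ (digitValue D) 1 n
      ≡⟨ cong (sumℚ (digitValue D) 1) (m+[n∸m]≡n L≤n) ⟨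
    sumℚ (digitValue D) 1 (L + R)
      ≡⟨ sumℚ-++ (digitValue D) 1 L R ⟩
    sumℚ (digitValue D) 1 L ℚ.+ tail D
      ≡⟨ cong (λ l → sumℚ (digitValue D) 1 l ℚ.+ tail D) L≡1+K-2 ⟩
    (digitValue D 1 ℚ.+ sumℚ (digitValue D) 2 K-2) ℚ.+ tail D ∎
    where open ≡-Reasoning

  0≤tail : ∀ D → 0ℚ ℚ.≤ tail D
  0≤tail D = sumℚ-nonNeg (digitValue D) (suc L) R (0≤digitValue D)

  tail<placeValue : ∀ D → (∀ k → D k < b) → tail D ℚ.< placeValue L
  tail<placeValue D D<b = ℚₚ.<-≤-trans tail<tail+ε (sumℚ-digitValue-bound D D<b R L)
    where
    tail<tail+ε : tail D ℚ.< tail D ℚ.+ placeValue (L + R)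
    tail<tail+ε = subst (ℚ._< tail D ℚ.+ placeValue (L + R)) (ℚₚ.+-identityʳ (tail D))
                    (ℚₚ.+-monoʳ-< (tail D) (0</ℕ 1 (b ^ (L + R)) {{m^n≢0 b (L + R)}} z<s))

  x₁≡ : ∀ j → faure b 1 j ≡ placeValue 1
  x₁≡ j = trans (ℚₚ.+-identityʳ _) (cong (λ d → d /ℕ b ^ 1) (pascalPow-e₁ (toℕ j)))

  -- In coordinates j ≥ 1 the digits of xₙ at positions 1, …, K - 1 are those of x₁.
  xₙ-suc≡ : ∀ i → faure b n (fsuc i) ≡ placeValue 1 ℚ.+ tail (pascalPow b n (suc (toℕ i)) V)
  xₙ-suc≡ i = trans (split D) (cong (ℚ._+ tail D) (begin
    digitValue D 1 ℚ.+ sumℚ (digitValue D) 2 K-2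
      ≡⟨ cong₂ ℚ._+_ (cong (λ d → d /ℕ b ^ 1) (pascalPow-V-one j 1+j<b)) (sumℚ-zero (digitValue D) 2 K-2 low) ⟩
    placeValue 1 ℚ.+ 0ℚ
      ≡⟨ ℚₚ.+-identityʳ _ ⟩
    placeValue 1 ∎))
    where
    open ≡-Reasoning
    j = toℕ i
    1+j<b = Finₚ.toℕ<n (fsuc i)
    D = pascalPow b n (suc j) V
    low : ∀ k → 2 ≤ k → k < 2 + K-2 → digitValue D k ≡ 0ℚ
    low (suc zero)    (s≤s ()) _
    low (suc (suc a)) _        2+a<K =
      trans (cong (λ d → (d /ℕ b ^ (2 + a)) {{m^n≢0 b (2 + a)}})
                  (pascalPow-V-low j a 1+j<b (subst (2 + a <_) (sym K≡2+K-2) 2+a<K)))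
            (ℚₚ.0/n≡0 (b ^ (2 + a)) {{m^n≢0 b (2 + a)}})

  coordinate-suc : ∀ i → ℚ.∣ faure b 1 (fsuc i) ℚ.- faure b n (fsuc i) ∣ ℚ.≤ placeValue L
  coordinate-suc i = subst₂ (λ x y → ℚ.∣ x ℚ.- y ∣ ℚ.≤ placeValue L) (sym (x₁≡ (fsuc i))) (sym (xₙ-suc≡ i))
    (∣x-[x+t]∣≤u (placeValue 1) (tail D) (placeValue L) (0≤tail D) (ℚₚ.<⇒≤ (tail<placeValue D D<b)))
    where
    D = pascalPow b n (suc (toℕ i)) V
    D<b = pascalPow<b n V (toℕ i)

  middle : ℚ
  middle = sumℚ (digitValue V) 2 K-2

  -- In coordinate 0 the digits of xₙ at positions 2, …, K - 1 are all b - 1.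
  middle+placeValue≡ : middle ℚ.+ placeValue L ≡ placeValue 1
  middle+placeValue≡ = trans (cong (λ l → middle ℚ.+ placeValue l) L≡1+K-2)
                      (sumℚ-maxDigits V K-2 1 mid)
    where
    mid : ∀ k → 2 ≤ k → k < 2 + K-2 → V k ≡ b-1
    mid (suc zero)    (s≤s ()) _
    mid (suc (suc a)) _        2+a<K = V-mid (suc a) (s≤s z≤n)
      (<-≤-trans (≤-trans (n≤1+n (2 + a)) (subst (2 + a <_) (sym K≡2+K-2) 2+a<K)) K≤M)

  xₙ-zero≡ : faure b n fzero ≡ middle ℚ.+ tail V
  xₙ-zero≡ = begin
    faure b n fzero                         ≡⟨ split V ⟩
    (digitValue V 1 ℚ.+ middle) ℚ.+ tail V  ≡⟨ cong (λ d → ((d /ℕ b ^ 1) ℚ.+ middle) ℚ.+ tail V)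
                                                    (digitVec-one M (≤-trans (s≤s z≤n) 2≤M)) ⟩
    ((0 /ℕ b ^ 1) ℚ.+ middle) ℚ.+ tail V    ≡⟨ cong (λ z → (z ℚ.+ middle) ℚ.+ tail V) (ℚₚ.0/n≡0 (b ^ 1)) ⟩
    (0ℚ ℚ.+ middle) ℚ.+ tail V              ≡⟨ cong (ℚ._+ tail V) (ℚₚ.+-identityˡ middle) ⟩
    middle ℚ.+ tail V                       ∎
    where open ≡-Reasoning

  coordinate-zero : ℚ.∣ faure b 1 fzero ℚ.- faure b n fzero ∣ ℚ.≤ placeValue L
  coordinate-zero = subst₂ (λ x y → ℚ.∣ x ℚ.- y ∣ ℚ.≤ placeValue L) (sym (x₁≡ fzero)) (sym xₙ-zero≡)
                      (∣x-[y+t]∣≤u {y = middle} middle+placeValue≡ (0≤tail V) (tail<placeValue V V<b))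

  distInf-x₁-xₙ≤ : distInf (faure b 1) (faure b n) ℚ.≤ placeValue L
  distInf-x₁-xₙ≤ = distInf≤ (faure b 1) (faure b n) (placeValue L) (0≤/ℕ 1 (b ^ L) {{m^n≢0 b L}}) coordinate
    where
    coordinate : ∀ j → ℚ.∣ faure b 1 j ℚ.- faure b n j ∣ ℚ.≤ placeValue L
    coordinate fzero    = coordinate-zero
    coordinate (fsuc i) = coordinate-suc i

  x₁≢xₙ : DistinctPts (faure b 1) (faure b n)
  x₁≢xₙ x₁≡xₙ = x≢y+t {y = middle} middle+placeValue≡ (0≤tail V) (tail<placeValue V V<b)
                  (trans (sym (x₁≡ fzero)) (trans (x₁≡xₙ fzero) xₙ-zero≡))

  sepRadius≤ : ∀ q → IsSepRadiusFaure b (b ^ M) q → q ℚ.≤ ½ ℚ.* distInf (faure b 1) (faure b n)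
  sepRadius≤ q (_ , minimal) = minimal 1 n (<-≤-trans (s≤s (s≤s z≤n)) b≤b^M) n<b^M x₁≢xₙ

  -- r is (b^M)^(-1/(b-1)) = b⁻ᴷ, characterised without roots.
  placeValue-K≤r : ∀ r → 0ℚ ℚ.< r → powℚ r b-1 ℚ.* (ℤ.+ (b ^ M) ℚ./ 1) ≡ 1ℚ → placeValue K ℚ.≤ r
  placeValue-K≤r r 0<r rᵇ⁻¹bᴹ≡1 with placeValue K ℚₚ.≤? r
  ... | yes b⁻ᴷ≤r = b⁻ᴷ≤r
  ... | no  b⁻ᴷ≰r = ⊥-elim (ℚₚ.<-irrefl (trans rᵇ⁻¹bᴹ≡1 (sym b⁻ᴷ⁽ᵇ⁻¹⁾bᴹ≡1))
                      (ℚₚ.*-monoˡ-<-pos bᴹ {{ℚ.positive (0</ℕ (b ^ M) 1 (m^n>0 b M))}}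
                        (powℚ-mono-< b-2 (ℚₚ.<⇒≤ 0<r) (ℚₚ.≰⇒> b⁻ᴷ≰r))))
    where
    bᴹ = ℤ.+ (b ^ M) ℚ./ 1
    b⁻ᴷ⁽ᵇ⁻¹⁾bᴹ≡1 : powℚ (placeValue K) b-1 ℚ.* bᴹ ≡ 1ℚ
    b⁻ᴷ⁽ᵇ⁻¹⁾bᴹ≡1 = begin
      powℚ (placeValue K) b-1 ℚ.* bᴹ          ≡⟨ cong (ℚ._* bᴹ) (powℚ-1/ℕ (b ^ K) b-1 {{m^n≢0 b K}}) ⟩
      (1 /ℕ (b ^ K) ^ b-1) ℚ.* (b ^ M /ℕ 1)   ≡⟨ /ℕ-* 1 ((b ^ K) ^ b-1) (b ^ M) 1 ⟩
      (1 * b ^ M) /ℕ ((b ^ K) ^ b-1 * 1)       ≡⟨ /ℕ-≡ (1 * b ^ M) ((b ^ K) ^ b-1 * 1) 1 1 same ⟩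
      1ℚ                                       ∎
      where
      open ≡-Reasoning
      instance
        bᴷ⁽ᵇ⁻¹⁾≢0 : NonZero ((b ^ K) ^ b-1)
        bᴷ⁽ᵇ⁻¹⁾≢0 = m^n≢0 (b ^ K) b-1 {{m^n≢0 b K}}
        bᴷ⁽ᵇ⁻¹⁾*1≢0 : NonZero ((b ^ K) ^ b-1 * 1)
        bᴷ⁽ᵇ⁻¹⁾*1≢0 = m*n≢0 _ 1
      same : 1 * b ^ M * 1 ≡ 1 * ((b ^ K) ^ b-1 * 1)
      same = begin
        1 * b ^ M * 1            ≡⟨ trans (*-identityʳ _) (*-identityˡ _) ⟩
        b ^ (b-1 * K)            ≡⟨ cong (b ^_) (*-comm b-1 K) ⟩
        b ^ (K * b-1)            ≡⟨ ^-*-assoc b K b-1 ⟨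
        (b ^ K) ^ b-1            ≡⟨ trans (*-identityˡ _) (*-identityʳ _) ⟨
        1 * ((b ^ K) ^ b-1 * 1)  ∎

  placeValue-L≡b*placeValue-K : placeValue L ≡ (b /ℕ 1) ℚ.* placeValue K
  placeValue-L≡b*placeValue-K = sym (trans (/ℕ-* b 1 1 (b ^ K) {{_}} {{m^n≢0 b K}})
    (/ℕ-≡ (b * 1) (1 * b ^ K) 1 (b ^ L) {{m*n≢0 1 (b ^ K) {{_}} {{m^n≢0 b K}}}} {{m^n≢0 b L}} bL≡K))
    where
    bL≡K : b * 1 * b ^ L ≡ 1 * (1 * b ^ K)
    bL≡K = begin
      b * 1 * b ^ L           ≡⟨ cong (λ l → b * 1 * b ^ l) L≡1+K-2 ⟩
      b * 1 * b ^ suc K-2     ≡⟨ solve 2 (λ b x → b :* con 1 :* x := con 1 :* (con 1 :* (b :* x)))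
                                         refl b (b ^ suc K-2) ⟩
      1 * (1 * b ^ (2 + K-2)) ≡⟨ cong (λ k → 1 * (1 * b ^ k)) K≡2+K-2 ⟨
      1 * (1 * b ^ K)         ∎
      where open ≡-Reasoning

  ½*distInf≤b/2*r : ∀ r → 0ℚ ℚ.< r → powℚ r b-1 ℚ.* (ℤ.+ (b ^ M) ℚ./ 1) ≡ 1ℚ →
                    ½ ℚ.* distInf (faure b 1) (faure b n) ℚ.≤ (ℤ.+ b ℚ./ 2) ℚ.* r
  ½*distInf≤b/2*r r 0<r rᵇ⁻¹bᴹ≡1 = begin
    ½ ℚ.* distInf (faure b 1) (faure b n)   ≤⟨ ℚₚ.*-monoˡ-≤-nonNeg ½ distInf-x₁-xₙ≤ ⟩
    ½ ℚ.* placeValue L                      ≡⟨ cong (½ ℚ.*_) placeValue-L≡b*placeValue-K ⟩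
    ½ ℚ.* ((b /ℕ 1) ℚ.* placeValue K)       ≤⟨ ℚₚ.*-monoˡ-≤-nonNeg ½ (ℚₚ.*-monoˡ-≤-nonNeg (b /ℕ 1)
                                                 {{ℚ.nonNegative (0≤/ℕ b 1)}} b⁻ᴷ≤r) ⟩
    ½ ℚ.* ((b /ℕ 1) ℚ.* r)                  ≡⟨ ℚₚ.*-assoc ½ (b /ℕ 1) r ⟨
    (½ ℚ.* (b /ℕ 1)) ℚ.* r                  ≡⟨ cong (ℚ._* r) ½*b≡b/2 ⟩
    (b /ℕ 2) ℚ.* r                          ∎
    where
    open ℚₚ.≤-Reasoning
    b⁻ᴷ≤r = placeValue-K≤r r 0<r rᵇ⁻¹bᴹ≡1
    ½*b≡b/2 : ½ ℚ.* (b /ℕ 1) ≡ b /ℕ 2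
    ½*b≡b/2 = trans (/ℕ-* 1 2 b 1)
                    (/ℕ-≡ (1 * b) (2 * 1) b 2 (solve 1 (λ x → con 1 :* x :* con 2 := x :* (con 2 :* con 1)) refl b))

-- Opened only here: with ℕ's _+_ in scope, +_ would make sections like (x +_) ambiguous.
open import Data.Integer using (+_)

mainTheorem9 : (b : ℕ) .{{_ : NonZero b}} → Prime b → (w : ℕ) → 1 ℕ.≤ w →
  let m = (b ∸ 1) ℕ.* b ^ w
      n = b ^ m ∸ b
  in (distInf (faure b 1) (faure b n)
        ℚ.≤ ((+ 1) ℚ./ (b ^ (b ^ w ∸ 1))) {{m^n≢0 b (b ^ w ∸ 1)}})
     × (∀ q → IsSepRadiusFaure b (b ^ m) q
          → q ℚ.≤ ½ ℚ.* distInf (faure b 1) (faure b n))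
     × (∀ r → 0ℚ ℚ.< r → powℚ r (b ∸ 1) ℚ.* ((+ (b ^ m)) ℚ./ 1) ≡ 1ℚ
          → ½ ℚ.* distInf (faure b 1) (faure b n)
              ℚ.≤ ((+ b) ℚ./ 2) ℚ.* r)
mainTheorem9 (suc zero)      isPrime _         _ = ⊥-elim (¬prime[1] isPrime)
mainTheorem9 (suc (suc b-2)) isPrime (suc w-1) _ = distInf-x₁-xₙ≤ , sepRadius≤ , ½*distInf≤b/2*r
  where open FaurePoints b-2 w-1 isPrime
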